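{- Let $P$ be a bounded and ranked poset with an EL-labeling $\lambda$. Let $Q\subseteq P$ be a ranked subposet of $P$ containing $\hat 0$ and $\hat 1$, whose rank function is the restriction of the rank function of $P$. Suppose that for all $x\preceq y$ in $Q$ the unique increasing maximal chain of the interval $[x,y]\subseteq P$ is contained in $Q$. Then the restriction $\lambda|_{\mathcal E(Q)}$ is an EL-labeling of $Q$.
   Context: For a bounded poset $P$ (with minimum $\hat 0$ and maximum $\hat 1$), $\mathcal E(P)$ denotes the set of edges of its Hasse diagram, i.e. pairs $x\prec\!\cdot\, y$ (covering relations); when $Q$ is ranked with the restricted rank function, every cover in $Q$ is a cover in $P$, so $\mathcal E(Q)\subseteq\mathcal E(P)$. An edge labeling is a map $\lambda:\mathcal E(P)\to\Lambda$ into a poset $\Lambda$. A maximal chain $x\prec\!\cdot\, z_1\prec\!\cdot\,\cdots\prec\!\cdot\, z_t\prec\!\cdot\, y$ of an interval $[x,y]$ has the word $\lambda(\mathcal E_{xz_1})\lambda(\mathcal E_{z_1z_2})\cdots\lambda(\mathcal E_{z_ty})$; the chain is increasing if this word is strictly increasing; maximal chains of an interval are compared lexicographically via their words. An EL-labeling of a bounded poset is an edge labeling such that every closed interval $[x,y]$ contains a unique increasing maximal chain, and this chain lexicographically precedes all other maximal chains of $[x,y]$. -}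

module Defs where

open import Data.Nat using (ℕ; suc)
open import Data.Fin using (Fin)
open import Data.Product using (Σ; Σ-syntax; _×_)
open import Data.Unit using (⊤)
open import Data.Empty using (⊥)
open import Data.List using (List; []; _∷_)
open import Data.List.Relation.Unary.All using (All)
open import Data.List.Relation.Unary.Linked using (Linked)
open import Relation.Binary.PropositionalEquality using (_≡_; _≢_)
open import Relation.Binary.Structures using (IsPartialOrder)
open import Function.Bundles using (_↔_)

record FinBoundedPoset : Set₁ where
  field
    Carrier        : Set
    _≤_            : Carrier → Carrier → Set
    isPartialOrder : IsPartialOrder _≡_ _≤_
    𝟘 𝟙            : Carrier
    𝟘-min          : ∀ x → 𝟘 ≤ x
    𝟙-max          : ∀ x → x ≤ 𝟙
    finite         : Σ[ n ∈ ℕ ] (Carrier ↔ Fin n)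

  _<_ : Carrier → Carrier → Set
  x < y = (x ≤ y) × (x ≢ y)

  _⋖_ : Carrier → Carrier → Set
  x ⋖ y = (x < y) × (∀ z → x < z → z < y → ⊥)

  SubCover : (Carrier → Set) → Carrier → Carrier → Set
  SubCover Q x y = Q x × Q y × (x < y) × (∀ z → Q z → x < z → z < y → ⊥)

record LabelPoset : Set₁ where
  field
    Carrier        : Set
    _≤_            : Carrier → Carrier → Set
    isPartialOrder : IsPartialOrder _≡_ _≤_

  _<_ : Carrier → Carrier → Set
  x < y = (x ≤ y) × (x ≢ y)

-- Saturated chains x = z₀ ⋖ z₁ ⋖ ... ⋖ z_k = y for a covering relation R.
-- In a finite poset these are exactly the maximal chains of the interval [x,y].
data MChain {A : Set} (R : A → A → Set) : A → A → Set where
  done : ∀ x → MChain R x x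
  step : ∀ {x z y} → R x z → MChain R z y → MChain R x y

verts : ∀ {A : Set} {R : A → A → Set} {x y} → MChain R x y → List A
verts (done x) = x ∷ []
verts (step {x = x} _ c) = x ∷ verts c

-- the word of labels of a chain; λ is an edge labeling, given as a function
-- on pairs (only its values on covering pairs are ever used)
word : ∀ {A L : Set} {R : A → A → Set} → (A → A → L) → ∀ {x y} → MChain R x y → List L
word lab (done _) = []
word lab (step {x = x} {z = z} _ c) = lab x z ∷ word lab c

data LexLt {L : Set} (_<_ : L → L → Set) : List L → List L → Set where
  halt  : ∀ {b bs} → LexLt _<_ [] (b ∷ bs)
  here  : ∀ {a b as bs} → a < b → LexLt _<_ (a ∷ as) (b ∷ bs)
  there : ∀ {a as bs} → LexLt _<_ as bs → LexLt _<_ (a ∷ as) (a ∷ bs)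

module _ (P : FinBoundedPoset) (Λ : LabelPoset) where
  open FinBoundedPoset P renaming (Carrier to A)
  open LabelPoset Λ using () renaming (Carrier to L; _<_ to _<Λ_)

  Increasing : ∀ {R : A → A → Set} → (A → A → L) → ∀ {x y} → MChain R x y → Set
  Increasing lab c = Linked _<Λ_ (word lab c)

  IsELLabeling : (Dom : A → Set) (R : A → A → Set) → (A → A → L) → Set
  IsELLabeling Dom R lab =
    ∀ x y → Dom x → Dom y → x ≤ y →
    Σ[ c ∈ MChain R x y ]
      ( Increasing lab c
      × (∀ (c′ : MChain R x y) → Increasing lab c′ → verts c′ ≡ verts c)
      × (∀ (c′ : MChain R x y) → verts c′ ≢ verts c → LexLt _<Λ_ (word lab c) (word lab c′)))

  IsRankFunction : (A → A → Set) → (A → ℕ) → Set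
  IsRankFunction R ρ = (ρ 𝟘 ≡ 0) × (∀ x y → R x y → ρ y ≡ suc (ρ x))

module Submission where

open import Defs
open import Data.Nat using (ℕ; suc; _<_; _≤_)
open import Data.Nat.Properties using (≤-refl; ≤-trans; ≤-reflexive; <⇒≤; <-≤-trans; <⇒≱; ≤-pred)
open import Data.Unit using (⊤; tt)
open import Data.Empty using (⊥; ⊥-elim)
open import Data.Product using (_,_; proj₁)
open import Data.List using (_∷_)
open import Data.List.Relation.Unary.All using (All; _∷_)
open import Data.List.Relation.Unary.Linked using (Linked)
open import Relation.Binary.PropositionalEquality
  using (_≡_; _≢_; refl; sym; trans; subst; subst₂; cong)

-- In a ranked poset a cover x ⋖ y raises the rank by exactly one,
-- so a cover of Q, which also raises the rank by one, has no element of P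
-- strictly between its ends and is a cover of P.  Hence the maximal chains of
-- an interval [x,y] of Q are exactly the maximal chains of [x,y] in P lying
-- in Q, with the same words.  The increasing chain of [x,y] in P lies in Q by
-- hypothesis, and uniqueness and lexicographic minimality are inherited.

module _ {A : Set} where

  MChain-map : ∀ {R S : A → A → Set} → (∀ {x y} → R x y → S x y) →
               ∀ {a b} → MChain R a b → MChain S a b
  MChain-map f (done x)   = done x
  MChain-map f (step r c) = step (f r) (MChain-map f c)

  verts-map : ∀ {R S : A → A → Set} (f : ∀ {x y} → R x y → S x y) →
              ∀ {a b} (c : MChain R a b) → verts (MChain-map f c) ≡ verts c
  verts-map f (done x)           = refl
  verts-map f (step {x = x} r c) = cong (x ∷_) (verts-map f c)

  word-map : ∀ {L : Set} {R S : A → A → Set} (lab : A → A → L) (f : ∀ {x y} → R x y → S x y) →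
             ∀ {a b} (c : MChain R a b) → word lab (MChain-map f c) ≡ word lab c
  word-map lab f (done x)                   = refl
  word-map lab f (step {x = x} {z = z} r c) = cong (lab x z ∷_) (word-map lab f c)

  All-verts-head : ∀ {R : A → A → Set} {Q : A → Set} {a b} (c : MChain R a b) →
                   All Q (verts c) → Q a
  All-verts-head (done _)   (q ∷ _) = q
  All-verts-head (step _ _) (q ∷ _) = q

  module _ {R S : A → A → Set} {Q : A → Set} (f : ∀ {x y} → Q x → Q y → R x y → S x y) where

    MChain-restrict : ∀ {a b} (c : MChain R a b) → All Q (verts c) → MChain S a b
    MChain-restrict (done x)   _        = done x
    MChain-restrict (step r c) (q ∷ qs) =
      step (f q (All-verts-head c qs) r) (MChain-restrict c qs)

    verts-restrict : ∀ {a b} (c : MChain R a b) (qs : All Q (verts c)) →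
                     verts (MChain-restrict c qs) ≡ verts c
    verts-restrict (done x)           _        = refl
    verts-restrict (step {x = x} r c) (_ ∷ qs) = cong (x ∷_) (verts-restrict c qs)

    word-restrict : ∀ {L : Set} (lab : A → A → L) {a b} (c : MChain R a b) (qs : All Q (verts c)) →
                    word lab (MChain-restrict c qs) ≡ word lab c
    word-restrict lab (done x)                   _        = refl
    word-restrict lab (step {x = x} {z = z} r c) (_ ∷ qs) = cong (lab x z ∷_) (word-restrict lab c qs)

module _ {A : Set} {R : A → A → Set} (ρ : A → ℕ) (ρ-step : ∀ x y → R x y → ρ y ≡ suc (ρ x)) where

  rank-<-step : ∀ {x y} → R x y → ρ x < ρ y
  rank-<-step {x} {y} r = ≤-reflexive (sym (ρ-step x y r))

  MChain-rank-≤ : ∀ {a b} → MChain R a b → ρ a ≤ ρ b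
  MChain-rank-≤ (done _)   = ≤-refl
  MChain-rank-≤ (step r c) = ≤-trans (<⇒≤ (rank-<-step r)) (MChain-rank-≤ c)

  MChain-rank-< : ∀ {a b} → MChain R a b → a ≢ b → ρ a < ρ b
  MChain-rank-< (done _)   a≢a = ⊥-elim (a≢a refl)
  MChain-rank-< (step r c) _   = <-≤-trans (rank-<-step r) (MChain-rank-≤ c)

module _ (P : FinBoundedPoset) where
  open FinBoundedPoset P renaming (Carrier to A; _<_ to _<P_; _≤_ to _≤P_)

  ⋖⇒SubCover : ∀ (Q : A → Set) {x y} → Q x → Q y → x ⋖ y → SubCover Q x y
  ⋖⇒SubCover Q qx qy (x<y , no-between) = qx , qy , x<y , λ z _ → no-between z

  module _ (ρ : A → ℕ) (ρ-step : ∀ x y → x ⋖ y → ρ y ≡ suc (ρ x))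
           (saturated : ∀ x y → x ≤P y → MChain _⋖_ x y) where

    <⇒rank-< : ∀ {x y} → x <P y → ρ x < ρ y
    <⇒rank-< {x} {y} (x≤y , x≢y) = MChain-rank-< ρ ρ-step (saturated x y x≤y) x≢y

    SubCover⇒⋖ : (Q : A → Set) → (∀ x y → SubCover Q x y → ρ y ≡ suc (ρ x)) →
                 ∀ {x y} → SubCover Q x y → x ⋖ y
    SubCover⇒⋖ Q ρQ-step {x} {y} cov@(_ , _ , x<y , _) = x<y , no-between
      where
      no-between : ∀ z → x <P z → z <P y → ⊥
      no-between z x<z z<y =
        <⇒≱ (<⇒rank-< x<z) (≤-pred (subst (ρ z <_) (ρQ-step x y cov) (<⇒rank-< z<y)))

module _ (P : FinBoundedPoset) (Λ : LabelPoset) where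
  open FinBoundedPoset P renaming (Carrier to A; _≤_ to _≤P_)
  open LabelPoset Λ using () renaming (Carrier to L; _<_ to _<Λ_)

  IsELLabeling-restrict :
    (lab : A → A → L) (Q : A → Set) →
    (∀ {x y} → SubCover Q x y → x ⋖ y) →
    IsELLabeling P Λ (λ _ → ⊤) _⋖_ lab →
    (∀ x y → Q x → Q y → x ≤P y →
       ∀ (c : MChain _⋖_ x y) → Increasing P Λ lab c → All Q (verts c)) →
    IsELLabeling P Λ Q (SubCover Q) lab
  IsELLabeling-restrict lab Q sub⇒cov el increasing⊆Q x y qx qy x≤y
    with el x y tt tt x≤y
  ... | c , c-inc , c-unique , c-least =
      cQ
    , subst (Linked _<Λ_) (sym (word-restrict cov⇒sub lab c qs)) c-inc
    , unique
    , least
    where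
    cov⇒sub : ∀ {u v} → Q u → Q v → u ⋖ v → SubCover Q u v
    cov⇒sub = ⋖⇒SubCover P Q

    qs : All Q (verts c)
    qs = increasing⊆Q x y qx qy x≤y c c-inc

    cQ : MChain (SubCover Q) x y
    cQ = MChain-restrict cov⇒sub c qs

    toP : ∀ {u v} → MChain (SubCover Q) u v → MChain _⋖_ u v
    toP = MChain-map sub⇒cov

    verts-toP : ∀ (c′ : MChain (SubCover Q) x y) → verts (toP c′) ≡ verts c → verts c′ ≡ verts cQ
    verts-toP c′ eq = trans (sym (verts-map sub⇒cov c′)) (trans eq (sym (verts-restrict cov⇒sub c qs)))

    unique : ∀ (c′ : MChain (SubCover Q) x y) → Increasing P Λ lab c′ → verts c′ ≡ verts cQ
    unique c′ c′-inc = verts-toP c′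
      (c-unique (toP c′) (subst (Linked _<Λ_) (sym (word-map lab sub⇒cov c′)) c′-inc))

    least : ∀ (c′ : MChain (SubCover Q) x y) → verts c′ ≢ verts cQ → LexLt _<Λ_ (word lab cQ) (word lab c′)
    least c′ c′≢cQ = subst₂ (LexLt _<Λ_) (sym (word-restrict cov⇒sub lab c qs)) (word-map lab sub⇒cov c′)
      (c-least (toP c′) (λ eq → c′≢cQ (verts-toP c′ eq)))

lemma3p6 : (P : FinBoundedPoset) (Λ : LabelPoset)
           (lab : FinBoundedPoset.Carrier P → FinBoundedPoset.Carrier P → LabelPoset.Carrier Λ)
           (ρ : FinBoundedPoset.Carrier P → ℕ) →
           IsRankFunction P Λ (FinBoundedPoset._⋖_ P) ρ →
           IsELLabeling P Λ (λ _ → ⊤) (FinBoundedPoset._⋖_ P) lab →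
           (Q : FinBoundedPoset.Carrier P → Set) →
           Q (FinBoundedPoset.𝟘 P) → Q (FinBoundedPoset.𝟙 P) →
           IsRankFunction P Λ (FinBoundedPoset.SubCover P Q) ρ →
           (∀ x y → Q x → Q y → FinBoundedPoset._≤_ P x y →
              ∀ (c : MChain (FinBoundedPoset._⋖_ P) x y) →
              Increasing P Λ lab c → All Q (verts c)) →
           IsELLabeling P Λ Q (FinBoundedPoset.SubCover P Q) lab
lemma3p6 P Λ lab ρ (_ , ρ-step) el Q _ _ (_ , ρQ-step) increasing⊆Q =
  IsELLabeling-restrict P Λ lab Q (SubCover⇒⋖ P ρ ρ-step saturated Q ρQ-step) el increasing⊆Q
  where
  saturated : ∀ x y → FinBoundedPoset._≤_ P x y → MChain (FinBoundedPoset._⋖_ P) x y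
  saturated x y x≤y = proj₁ (el x y tt tt x≤y)
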